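{- For every integer $n \geq 1$, $c(\Gamma_n) \geq \left\lfloor \frac{n+5}{6} \right\rfloor$ and $c(\Lambda_n) \geq \left\lfloor \frac{n+5}{6} \right\rfloor$, where $\Gamma_n$ is the $n$-dimensional Fibonacci cube and $\Lambda_n$ is the $n$-dimensional Lucas cube.
   Context: The $n$-dimensional Fibonacci cube $\Gamma_n$ is the subgraph of the hypercube $Q_n$ (vertex set $\{0,1\}^n$, adjacency = differing in exactly one position) induced by all binary strings of length $n$ containing no two consecutive 1's. The $n$-dimensional Lucas cube $\Lambda_n$ is the subgraph of $Q_n$ induced by all binary strings $x_1\cdots x_n$ with no two consecutive 1's and not having both $x_1=1$ and $x_n=1$. Cops and Robbers on a finite simple graph $G$ with $k$ cops: the cops choose starting vertices, then the robber does; in each round all cops move and then the robber moves, each player moving to a neighbor or staying put. The cops win if a cop occupies the robber's vertex; otherwise the robber wins. The cop number $c(G)$ is the minimum $k$ for which the cops have a strategy guaranteeing capture. -}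

module Defs where

open import Data.Nat using (ℕ; zero; suc; _+_; _<_)
open import Data.Bool using (Bool; true; false; _∧_; _∨_; not; T)
open import Data.Fin using (Fin)
open import Data.Vec using (Vec; []; _∷_; head; last)
open import Data.Product using (Σ; ∃; _×_; _,_; proj₁)
open import Data.Sum using (_⊎_)
open import Relation.Binary.PropositionalEquality using (_≡_)
open import Relation.Nullary using (¬_)

record Graph : Set₁ where
  field
    V      : Set
    Adj    : V → V → Set
    irrefl : ∀ {v} → ¬ Adj v v
    sym    : ∀ {u v} → Adj u v → Adj v u

module _ (G : Graph) where
  open Graph G

  Move : V → V → Set
  Move u v = (u ≡ v) ⊎ Adj u v

  Caught : {k : ℕ} → (Fin k → V) → V → Set
  Caught C r = ∃ λ i → C i ≡ r

  CopMove : {k : ℕ} → (Fin k → V) → (Fin k → V) → Set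
  CopMove C C' = ∀ i → Move (C i) (C' i)

  -- CopWin C r : cops at C, robber at r, cops to move; the cops have a
  -- strategy guaranteeing capture (least fixed point / well-founded
  -- strategy tree of the reachability game).
  data CopWin {k : ℕ} : (Fin k → V) → V → Set where
    step : ∀ {C r} (C' : Fin k → V) → CopMove C C' →
           (Caught C' r ⊎ (∀ r' → Move r r' → Caught C' r' ⊎ CopWin C' r')) →
           CopWin C r

  CopsWin : ℕ → Set
  CopsWin k = Σ (Fin k → V) λ C → ∀ r → Caught C r ⊎ CopWin C r

  CopNumber≥ : ℕ → Set
  CopNumber≥ m = ∀ k → k < m → ¬ CopsWin k

hamming : {n : ℕ} → Vec Bool n → Vec Bool n → ℕ
hamming [] [] = 0
hamming (true ∷ xs) (false ∷ ys) = suc (hamming xs ys)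
hamming (false ∷ xs) (true ∷ ys) = suc (hamming xs ys)
hamming (true ∷ xs) (true ∷ ys) = hamming xs ys
hamming (false ∷ xs) (false ∷ ys) = hamming xs ys

noConsec : {n : ℕ} → Vec Bool n → Bool
noConsec [] = true
noConsec (x ∷ []) = true
noConsec (x ∷ y ∷ xs) = not (x ∧ y) ∧ noConsec (y ∷ xs)

lucasOK : {n : ℕ} → Vec Bool n → Bool
lucasOK [] = true
lucasOK (x ∷ xs) = noConsec (x ∷ xs) ∧ not (x ∧ last (x ∷ xs))

inducedCube : (n : ℕ) → (Vec Bool n → Bool) → Graph
inducedCube n P = record
  { V      = Σ (Vec Bool n) (λ x → T (P x))
  ; Adj    = λ u v → hamming (proj₁ u) (proj₁ v) ≡ 1
  ; irrefl = λ {v} → irr (proj₁ v)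
  ; sym    = λ {u} {v} → sy (proj₁ u) (proj₁ v)
  }
  where
    irr : ∀ {m} (x : Vec Bool m) → ¬ hamming x x ≡ 1
    irr [] ()
    irr (true ∷ x) = irr x
    irr (false ∷ x) = irr x
    hs : ∀ {m} (x y : Vec Bool m) → hamming x y ≡ hamming y x
    hs [] [] = Relation.Binary.PropositionalEquality.refl
    hs (true ∷ x) (true ∷ y) = hs x y
    hs (true ∷ x) (false ∷ y) = Relation.Binary.PropositionalEquality.cong suc (hs x y)
    hs (false ∷ x) (true ∷ y) = Relation.Binary.PropositionalEquality.cong suc (hs x y)
    hs (false ∷ x) (false ∷ y) = hs x y
    sy : ∀ {m} (x y : Vec Bool m) → hamming x y ≡ 1 → hamming y x ≡ 1
    sy x y p = Relation.Binary.PropositionalEquality.trans (hs y x) p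

FibonacciCube : ℕ → Graph
FibonacciCube n = inducedCube n noConsec

LucasCube : ℕ → Graph
LucasCube n = inducedCube n lucasOK

{-# OPTIONS --safe #-}
module Submission where

-- The robber stays among the Fibonacci strings ending in 0 (fib₀ below), which lie in
-- both Γₙ and Λₙ, and keeps every cop at Hamming distance at least 2.  In the hypercube
-- a vertex c ≠ r is within distance 1 of at most two vertices of the closed
-- neighbourhood N[r], while a vertex r of fib₀ has at least (n − 1)/3 neighbours in fib₀.
-- For k < ⌊(n + 5)/6⌋ we have 6k < n, so r and these neighbours are more than 2k
-- vertices and, whatever the k cops do, one of them is at distance at least 2 from all
-- cops: the robber moves there.  His starting vertex is found the same way in N[0ⁿ],
-- where each cop occupies at most one vertex.

open import Defs
open import Data.Bool using (Bool; true; false; not; _∧_; T; if_then_else_)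
open import Data.Bool.Properties using (T-irrelevant; T-∧; T-not-≡)
open import Data.Fin as Fin using (Fin)
open import Data.List using (List; []; _∷_; map; length; filterᵇ)
open import Data.List.Membership.Propositional using (_∈_)
open import Data.List.Membership.Propositional.Properties using (∈-filter⁻; ∈-map⁻)
open import Data.List.Relation.Unary.Any using (here; there)
open import Data.Nat using (ℕ; zero; suc; _+_; _*_; _≤_; _<_; _≥_; _<ᵇ_; z≤n; s≤s; s≤s⁻¹)
open import Data.Nat.DivMod using (_/_; m/n*n≤m)
open import Data.Nat.Properties
  using (≤-refl; ≤-trans; m≤n⇒m≤1+n; m≤n+m; +-suc; +-comm; +-identityʳ; +-assoc;
         +-mono-≤; +-monoˡ-≤; +-monoʳ-≤; +-cancelˡ-≤; +-cancelˡ-<;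
         *-assoc; *-monoˡ-≤; *-cancelʳ-≤; module ≤-Reasoning)
open import Data.Product using (∃; _×_; _,_; proj₁; proj₂)
open import Data.Product.Properties using (Σ-≡,≡→≡)
open import Data.Sum using (_⊎_; inj₁; inj₂)
open import Data.Vec using (Vec; []; _∷_; last; replicate)
open import Function using (_∘_; Equivalence)
open import Relation.Binary.PropositionalEquality using (_≡_; _≢_; refl; sym; trans; cong; subst)
open import Relation.Nullary using (¬_; contradiction)
open import Relation.Nullary.Decidable using (T?)

𝟙 : Bool → ℕ
𝟙 b = if b then 1 else 0

𝟙≤1 : ∀ b → 𝟙 b ≤ 1
𝟙≤1 true  = s≤s z≤n
𝟙≤1 false = z≤n

𝟙-T : ∀ {b} → T b → 𝟙 b ≡ 1
𝟙-T {true} _ = refl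

count : {A : Set} → (A → Bool) → List A → ℕ
count p []       = 0
count p (x ∷ xs) = 𝟙 (p x) + count p xs

count-none : {A : Set} (xs : List A) → count (λ _ → false) xs ≡ 0
count-none []       = refl
count-none (x ∷ xs) = count-none xs

count-map : {A B : Set} (p : B → Bool) (f : A → B) (xs : List A) →
            count p (map f xs) ≡ count (p ∘ f) xs
count-map p f []       = refl
count-map p f (x ∷ xs) = cong (𝟙 (p (f x)) +_) (count-map p f xs)

length-filterᵇ : {A : Set} (p : A → Bool) (xs : List A) → length (filterᵇ p xs) ≡ count p xs
length-filterᵇ p []       = refl
length-filterᵇ p (x ∷ xs) with p x
... | true  = cong suc (length-filterᵇ p xs)
... | false = length-filterᵇ p xs

count-filterᵇ-≤ : {A : Set} (p q : A → Bool) (xs : List A) → count p (filterᵇ q xs) ≤ count p xs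
count-filterᵇ-≤ p q []       = z≤n
count-filterᵇ-≤ p q (x ∷ xs) with q x
... | true  = +-monoʳ-≤ (𝟙 (p x)) (count-filterᵇ-≤ p q xs)
... | false = ≤-trans (count-filterᵇ-≤ p q xs) (m≤n+m _ (𝟙 (p x)))

count+count-not : {A : Set} (p : A → Bool) (xs : List A) →
                  count p xs + count (not ∘ p) xs ≡ length xs
count+count-not p []       = refl
count+count-not p (x ∷ xs) with p x
... | true  = cong suc (count+count-not p xs)
... | false = trans (+-suc _ _) (cong suc (count+count-not p xs))

pigeonhole : {A : Set} {k : ℕ} (cap : ℕ) (p : Fin k → A → Bool) (xs : List A) →
             (∀ i → count (p i) xs ≤ cap) → k * cap < length xs →
             ∃ λ y → y ∈ xs × ∀ i → p i y ≡ false
pigeonhole {k = zero}  cap p (x ∷ xs) _ _ = x , here refl , λ ()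
pigeonhole {k = suc k} cap p xs few long =
  let y , y∈ , avoids = pigeonhole cap (p ∘ Fin.suc) rest
                          (λ i → ≤-trans (count-filterᵇ-≤ (p (Fin.suc i)) _ xs) (few (Fin.suc i)))
                          rest-long
      y∈xs , ¬p₀y = ∈-filter⁻ (T? ∘ p₀ᶜ) y∈
  in y , y∈xs , λ { Fin.zero → Equivalence.to T-not-≡ ¬p₀y ; (Fin.suc i) → avoids i }
  where
    p₀ᶜ = not ∘ p Fin.zero
    rest = filterᵇ p₀ᶜ xs
    open ≤-Reasoning
    rest-long : k * cap < length rest
    rest-long = +-cancelˡ-< cap _ _ (begin-strict
      cap + k * cap                          <⟨ long ⟩
      length xs                              ≡⟨ count+count-not (p Fin.zero) xs ⟨
      count (p Fin.zero) xs + count p₀ᶜ xs   ≤⟨ +-monoˡ-≤ _ (few Fin.zero) ⟩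
      cap + count p₀ᶜ xs                     ≡⟨ cong (cap +_) (length-filterᵇ p₀ᶜ xs) ⟨
      cap + length rest                      ∎)

module _ (G : Graph) where
  open Graph G using (V)

  uncaught : ∀ {k} {C : Fin k → V} {r} → (∀ i → ¬ Move G (C i) r) → ¬ Caught G C r
  uncaught far (i , refl) = far i (inj₁ refl)

  module _ {k : ℕ} (S : V → Set)
           (escape : ∀ (C : Fin k → V) r → S r → (∀ i → C i ≢ r) →
                     ∃ λ y → S y × Move G r y × ∀ i → ¬ Move G (C i) y) where

    evade : ∀ {C r} → S r → (∀ i → ¬ Move G (C i) r) → ¬ CopWin G C r
    evade Sr far (step C′ moved (inj₁ (i , refl))) = far i (moved i)
    evade {C} {r} Sr far (step C′ moved (inj₂ respond))
      with y , Sy , r→y , far′ ← escape C′ r Sr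
                                   (λ i C′ᵢ≡r → far i (subst (Move G (C i)) C′ᵢ≡r (moved i)))
      with respond y r→y
    ... | inj₁ caught = uncaught far′ caught
    ... | inj₂ copWin = evade Sy far′ copWin

    escape⇒robber-wins : (∀ (C : Fin k → V) → ∃ λ r → S r × ∀ i → C i ≢ r) → ¬ CopsWin G k
    escape⇒robber-wins unoccupied (C , win)
      with r , Sr , free ← unoccupied C
      with y , Sy , _ , far ← escape C r Sr free
      with win y
    ... | inj₁ caught = uncaught far caught
    ... | inj₂ copWin = evade Sy far copWin

flips : ∀ {n} → Vec Bool n → List (Vec Bool n)
flips []       = []
flips (x ∷ xs) = (not x ∷ xs) ∷ map (x ∷_) (flips xs)

hamming-refl : ∀ {n} (x : Vec Bool n) → hamming x x ≡ 0
hamming-refl []         = refl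
hamming-refl (true ∷ x)  = hamming-refl x
hamming-refl (false ∷ x) = hamming-refl x

hamming≡0⇒≡ : ∀ {n} {x y : Vec Bool n} → hamming x y ≡ 0 → x ≡ y
hamming≡0⇒≡ {x = []}        {[]}        _ = refl
hamming≡0⇒≡ {x = true ∷ x}  {true ∷ y}  h = cong (true ∷_) (hamming≡0⇒≡ h)
hamming≡0⇒≡ {x = false ∷ x} {false ∷ y} h = cong (false ∷_) (hamming≡0⇒≡ h)

hamming-∷ : ∀ {n} b (x y : Vec Bool n) → hamming (b ∷ x) (b ∷ y) ≡ hamming x y
hamming-∷ true  x y = refl
hamming-∷ false x y = refl

hamming-not∷ : ∀ {n} b (x y : Vec Bool n) → hamming (b ∷ x) (not b ∷ y) ≡ suc (hamming x y)
hamming-not∷ true  x y = refl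
hamming-not∷ false x y = refl

∈-flips⇒hamming≡1 : ∀ {n} {x y : Vec Bool n} → y ∈ flips x → hamming x y ≡ 1
∈-flips⇒hamming≡1 {x = b ∷ x} (here refl) = trans (hamming-not∷ b x x) (cong suc (hamming-refl x))
∈-flips⇒hamming≡1 {x = b ∷ x} (there y∈) with z , z∈ , refl ← ∈-map⁻ (b ∷_) y∈ =
  trans (hamming-∷ b x z) (∈-flips⇒hamming≡1 z∈)

-- Phrased with _<ᵇ_ so that within (suc t) (b ∷ c) (not b ∷ y) reduces to within t c y.
within : ∀ {n} → ℕ → Vec Bool n → Vec Bool n → Bool
within t c y = hamming c y <ᵇ suc t

within-refl : ∀ {n} t (x : Vec Bool n) → T (within t x x)
within-refl t x rewrite hamming-refl x = _

count-within₀-closed : ∀ {n} (c r : Vec Bool n) → count (within 0 c) (r ∷ flips r) ≤ 1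
count-within₀-closed [] [] = s≤s z≤n
count-within₀-closed (true ∷ c) (true ∷ r)
  rewrite count-map (within 0 (true ∷ c)) (true ∷_) (flips r) = count-within₀-closed c r
count-within₀-closed (false ∷ c) (false ∷ r)
  rewrite count-map (within 0 (false ∷ c)) (false ∷_) (flips r) = count-within₀-closed c r
count-within₀-closed (true ∷ c) (false ∷ r)
  rewrite count-map (within 0 (true ∷ c)) (false ∷_) (flips r) | count-none (flips r)
        | +-identityʳ (𝟙 (within 0 c r)) = 𝟙≤1 _
count-within₀-closed (false ∷ c) (true ∷ r)
  rewrite count-map (within 0 (false ∷ c)) (true ∷_) (flips r) | count-none (flips r)
        | +-identityʳ (𝟙 (within 0 c r)) = 𝟙≤1 _

m≢0⇒m<ᵇ1≡false : ∀ {m} → m ≢ 0 → (m <ᵇ 1) ≡ false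
m≢0⇒m<ᵇ1≡false {zero}  m≢0 = contradiction refl m≢0
m≢0⇒m<ᵇ1≡false {suc _} _   = refl

count-within₁-closed-heads≢ : ∀ {n} (c r : Vec Bool n) →
  𝟙 (within 0 c r) + (𝟙 (within 1 c r) + count (within 0 c) (flips r)) ≤ 2
count-within₁-closed-heads≢ c r = begin
  a + (b + z) ≡⟨ cong (a +_) (+-comm b z) ⟩
  a + (z + b) ≡⟨ +-assoc a z b ⟨
  a + z + b   ≤⟨ +-mono-≤ (count-within₀-closed c r) (𝟙≤1 _) ⟩
  2           ∎
  where
    open ≤-Reasoning
    a = 𝟙 (within 0 c r)
    b = 𝟙 (within 1 c r)
    z = count (within 0 c) (flips r)

count-within₁-closed : ∀ {n} (c r : Vec Bool n) → hamming c r ≢ 0 →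
                       count (within 1 c) (r ∷ flips r) ≤ 2
count-within₁-closed [] [] c≢r = contradiction refl c≢r
count-within₁-closed (true ∷ c) (true ∷ r) c≢r
  rewrite count-map (within 1 (true ∷ c)) (true ∷_) (flips r) | m≢0⇒m<ᵇ1≡false c≢r =
  count-within₁-closed c r c≢r
count-within₁-closed (false ∷ c) (false ∷ r) c≢r
  rewrite count-map (within 1 (false ∷ c)) (false ∷_) (flips r) | m≢0⇒m<ᵇ1≡false c≢r =
  count-within₁-closed c r c≢r
count-within₁-closed (true ∷ c) (false ∷ r) _
  rewrite count-map (within 1 (true ∷ c)) (false ∷_) (flips r) = count-within₁-closed-heads≢ c r
count-within₁-closed (false ∷ c) (true ∷ r) _
  rewrite count-map (within 1 (false ∷ c)) (true ∷_) (flips r) = count-within₁-closed-heads≢ c r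

fibTail : ∀ {n} → Bool → Vec Bool n → Bool
fibTail b []       = not b
fibTail b (x ∷ xs) = not (b ∧ x) ∧ fibTail x xs

fib₀ : ∀ {n} → Vec Bool n → Bool
fib₀ = fibTail false

fib₀-replicate : ∀ n → T (fib₀ (replicate n false))
fib₀-replicate zero    = _
fib₀-replicate (suc n) = fib₀-replicate n

fibTail⇒noConsec : ∀ {n} b (xs : Vec Bool n) → T (fibTail b xs) → T (noConsec xs)
fibTail⇒noConsec b []           _ = _
fibTail⇒noConsec b (x ∷ [])     _ = _
fibTail⇒noConsec b (x ∷ y ∷ ys) h =
  let fibTail-x = proj₂ (Equivalence.to (T-∧ {not (b ∧ x)}) h)
  in Equivalence.from T-∧ (proj₁ (Equivalence.to (T-∧ {not (x ∧ y)}) fibTail-x) ,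
                           fibTail⇒noConsec x (y ∷ ys) fibTail-x)

fibTail⇒¬last : ∀ {n} b (xs : Vec Bool (suc n)) → T (fibTail b xs) → T (not (last xs))
fibTail⇒¬last b (x ∷ [])     h = proj₂ (Equivalence.to (T-∧ {not (b ∧ x)}) h)
fibTail⇒¬last b (x ∷ y ∷ ys) h =
  fibTail⇒¬last x (y ∷ ys) (proj₂ (Equivalence.to (T-∧ {not (b ∧ x)}) h))

fib₀⇒lucasOK : ∀ {n} (xs : Vec Bool n) → T (fib₀ xs) → T (lucasOK xs)
fib₀⇒lucasOK []       _ = _
fib₀⇒lucasOK (x ∷ xs) h =
  Equivalence.from T-∧ (fibTail⇒noConsec false (x ∷ xs) h ,
                        not-∧ʳ x (fibTail⇒¬last false (x ∷ xs) h))
  where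
    not-∧ʳ : ∀ a {b} → T (not b) → T (not (a ∧ b))
    not-∧ʳ true  t = t
    not-∧ʳ false _ = _

fib₀-degree : ∀ {n} → Vec Bool n → ℕ
fib₀-degree r = count fib₀ (flips r)

fib₀-degree-0∷ : ∀ {n} (xs : Vec Bool n) →
                 fib₀-degree (false ∷ xs) ≡ 𝟙 (fib₀ (true ∷ xs)) + fib₀-degree xs
fib₀-degree-0∷ xs = cong (𝟙 (fib₀ (true ∷ xs)) +_) (count-map fib₀ (false ∷_) (flips xs))

fib₀-degree-10∷ : ∀ {n} (xs : Vec Bool n) →
                  fib₀-degree (true ∷ false ∷ xs) ≡ 𝟙 (fib₀ xs) + fib₀-degree xs
fib₀-degree-10∷ xs = cong (𝟙 (fib₀ xs) +_) (trans
  (count-map fib₀ (true ∷_) (map (false ∷_) (flips xs)))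
  (count-map (fib₀ ∘ (true ∷_)) (false ∷_) (flips xs)))

fib₀-degree-bound-step : ∀ {m d d′ b} j → j ≤ 3 → T b → d′ ≡ 𝟙 b + d →
                         m ≤ 1 + d * 3 → j + m ≤ 1 + d′ * 3
fib₀-degree-bound-step {b = true} j j≤3 _ refl m≤ = +-mono-≤ j≤3 m≤

fib₀-degree-bound : ∀ {n} (xs : Vec Bool n) → T (fib₀ xs) → n ≤ 1 + fib₀-degree xs * 3
fib₀-degree-bound []                          _ = z≤n
fib₀-degree-bound (false ∷ [])                _ = s≤s z≤n
fib₀-degree-bound (true ∷ false ∷ xs)         h =
  fib₀-degree-bound-step 2 (s≤s (s≤s z≤n)) h (fib₀-degree-10∷ xs) (fib₀-degree-bound xs h)
fib₀-degree-bound (false ∷ xs@(false ∷ ys))   h =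
  fib₀-degree-bound-step 1 (s≤s z≤n) h (fib₀-degree-0∷ xs) (fib₀-degree-bound xs h)
fib₀-degree-bound (false ∷ true ∷ false ∷ xs) h =
  fib₀-degree-bound-step 3 ≤-refl h
    (trans (fib₀-degree-0∷ (true ∷ false ∷ xs)) (fib₀-degree-10∷ xs)) (fib₀-degree-bound xs h)

module _ {n : ℕ} (P : Vec Bool n → Bool) where
  private
    Q : Graph
    Q = inducedCube n P
  open Graph Q using (V)

  vertex-≡ : {u v : V} → proj₁ u ≡ proj₁ v → u ≡ v
  vertex-≡ eq = Σ-≡,≡→≡ (eq , T-irrelevant _ _)

  ≡⇒within₀ : {u v : V} → u ≡ v → T (within 0 (proj₁ u) (proj₁ v))
  ≡⇒within₀ {u} refl = within-refl 0 (proj₁ u)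

  move⇒within₁ : {u v : V} → Move Q u v → T (within 1 (proj₁ u) (proj₁ v))
  move⇒within₁ {u} (inj₁ refl) = within-refl 1 (proj₁ u)
  move⇒within₁ (inj₂ adj) rewrite adj = _

  module _ (S : Vec Bool n → Bool) (S⊆P : ∀ y → T (S y) → T (P y))
           (z : Vec Bool n) (Sz : T (S z))
           {k : ℕ} (large : ∀ r → T (S r) → k * 2 < count S (r ∷ flips r)) where

    unthreatened-move : ∀ {r} (threat : Fin k → Vec Bool n → Bool) → T (S r) →
      (∀ i → count (threat i) (r ∷ flips r) ≤ 2) →
      ∃ λ y → (y ≡ r ⊎ hamming r y ≡ 1) × T (S y) × ∀ i → threat i y ≡ false
    unthreatened-move {r} threat Sr few =
      let y , y∈ , avoids = pigeonhole 2 threat (filterᵇ S (r ∷ flips r))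
                              (λ i → ≤-trans (count-filterᵇ-≤ (threat i) S _) (few i))
                              (subst (k * 2 <_) (sym (length-filterᵇ S _)) (large r Sr))
          y∈closed , Sy = ∈-filter⁻ (T? ∘ S) y∈
      in y , closed-neighbour y∈closed , Sy , avoids
      where
        closed-neighbour : ∀ {y} → y ∈ r ∷ flips r → y ≡ r ⊎ hamming r y ≡ 1
        closed-neighbour (here y≡r) = inj₁ y≡r
        closed-neighbour (there y∈) = inj₂ (∈-flips⇒hamming≡1 y∈)

    unoccupied : (C : Fin k → V) → ∃ λ r → T (S (proj₁ r)) × ∀ i → C i ≢ r
    unoccupied C =
      let y , _ , Sy , avoids = unthreatened-move (λ i → within 0 (proj₁ (C i))) Sz
                                  (λ i → m≤n⇒m≤1+n (count-within₀-closed (proj₁ (C i)) z))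
      in (y , S⊆P y Sy) , Sy , λ i Cᵢ≡y → subst T (avoids i) (≡⇒within₀ Cᵢ≡y)

    escape : ∀ (C : Fin k → V) r → T (S (proj₁ r)) → (∀ i → C i ≢ r) →
             ∃ λ y → T (S (proj₁ y)) × Move Q r y × ∀ i → ¬ Move Q (C i) y
    escape C r Sr free =
      let y , r~y , Sy , avoids = unthreatened-move (λ i → within 1 (proj₁ (C i))) Sr
                                    (λ i → count-within₁-closed (proj₁ (C i)) (proj₁ r)
                                             (free i ∘ vertex-≡ ∘ hamming≡0⇒≡))
      in (y , S⊆P y Sy) , Sy , move r~y , λ i Cᵢ→y → subst T (avoids i) (move⇒within₁ Cᵢ→y)
      where
        move : ∀ {y} {Py : T (P y)} → y ≡ proj₁ r ⊎ hamming (proj₁ r) y ≡ 1 → Move Q r (y , Py)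
        move (inj₁ y≡r) = inj₁ (vertex-≡ (sym y≡r))
        move (inj₂ adj) = inj₂ adj

    cube-robber-wins : ¬ CopsWin Q k
    cube-robber-wins = escape⇒robber-wins Q (λ v → T (S (proj₁ v))) escape unoccupied

m<[n+5]/6⇒m*6<n : ∀ {m} n → m < (n + 5) / 6 → m * 6 < n
m<[n+5]/6⇒m*6<n {m} n m< = +-cancelˡ-≤ 5 _ _ (begin
  suc m * 6          ≤⟨ *-monoˡ-≤ 6 m< ⟩
  (n + 5) / 6 * 6    ≤⟨ m/n*n≤m (n + 5) 6 ⟩
  n + 5              ≡⟨ +-comm n 5 ⟩
  5 + n              ∎)
  where open ≤-Reasoning

fib₀-closedNbhd-large : ∀ {n} k → k * 6 < n → ∀ (r : Vec Bool n) → T (fib₀ r) →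
                        k * 2 < count fib₀ (r ∷ flips r)
fib₀-closedNbhd-large {n} k k*6<n r h rewrite 𝟙-T {fib₀ r} h =
  s≤s (*-cancelʳ-≤ (k * 2) (fib₀-degree r) 3 (s≤s⁻¹ (begin-strict
    k * 2 * 3              ≡⟨ *-assoc k 2 3 ⟩
    k * 6                  <⟨ k*6<n ⟩
    n                      ≤⟨ fib₀-degree-bound r h ⟩
    1 + fib₀-degree r * 3  ∎)))
  where open ≤-Reasoning

cube-copNumber≥ : ∀ {n} (P : Vec Bool n → Bool) → (∀ y → T (fib₀ y) → T (P y)) →
                  CopNumber≥ (inducedCube n P) ((n + 5) / 6)
cube-copNumber≥ {n} P fib₀⊆P k k< =
  cube-robber-wins P fib₀ fib₀⊆P (replicate n false) (fib₀-replicate n)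
    (fib₀-closedNbhd-large k (m<[n+5]/6⇒m*6<n n k<))

corollary3p3 : (n : ℕ) → n ≥ 1 →
    CopNumber≥ (FibonacciCube n) ((n + 5) / 6) × CopNumber≥ (LucasCube n) ((n + 5) / 6)
corollary3p3 n _ =
  cube-copNumber≥ noConsec (fibTail⇒noConsec false) , cube-copNumber≥ lucasOK fib₀⇒lucasOK
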